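{- Let $G$ be a co-chordal graph (i.e. $G^c$ is chordal) such that each vertex of $G$ lies in at most two maximal independent sets of $G$, and let $\mathcal{T}_{\mathcal{K}^c}$ be a clique tree of $G^c$. Then $\operatorname{bc}(G)\leq \chi_r'(\mathcal{T}_{\mathcal{K}^c})$ (indeed, a biclique cover of $G$ of size at most $\chi_r'(\mathcal{T}_{\mathcal{K}^c})$ can be constructed).
   Context: A graph is chordal if it has no induced cycle of length greater than 3. A clique tree of a chordal graph $H$ is a tree whose vertices are exactly the maximal cliques of $H$ and which satisfies the clique-intersection property: for any two distinct maximal cliques $K^1,K^2$, every clique on the path between them in the tree contains $K^1\cap K^2$. $\operatorname{bc}(G)$ is the minimum number of complete bipartite subgraphs of $G$ such that every edge of $G$ lies in at least one of them. For a tree $T=(V,E)$, a map $\varphi:E\to\{1,\dots,r\}$ is an edge-ranking if for any distinct edges $e_1,e_2$ with $\varphi(e_1)=\varphi(e_2)$ there is an edge $e_3$ on the path between them with $\varphi(e_3)>\varphi(e_1)$; $\chi_r'(T)$ is the minimum $r$ over all edge-rankings of $T$. -}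

module Defs where

open import Data.Nat using (ℕ; zero; suc; _≤_; _<_)
open import Data.Fin using (Fin; toℕ; inject₁; fromℕ) renaming (zero to fzero; suc to fsuc)
open import Data.Fin.Properties using (_≟_)
open import Data.Fin.Subset using (Subset; _∈_; _∉_; _⊆_; _∩_)
open import Data.Bool using (Bool; true; false; not; _∧_)
open import Data.Product using (Σ; _×_; _,_; ∃; ∃-syntax)
open import Data.Sum using (_⊎_)
open import Data.List using (List; length)
open import Data.List.Relation.Unary.All using (All)
open import Data.List.Relation.Unary.Any using (Any)
open import Relation.Binary.PropositionalEquality using (_≡_; _≢_; refl; cong)
open import Relation.Nullary using (¬_)
open import Relation.Nullary.Decidable using (⌊_⌋)
open import Function.Definitions using (Injective)

record Graph (n : ℕ) : Set where
  field
    adj     : Fin n → Fin n → Bool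
    adj-sym : ∀ u v → adj u v ≡ adj v u
    irrefl  : ∀ u → adj u u ≡ false
open Graph public

private
  ≟-sym : ∀ {n} (u v : Fin n) → ⌊ u ≟ v ⌋ ≡ ⌊ v ≟ u ⌋
  ≟-sym u v with u ≟ v | v ≟ u
  ... | Relation.Nullary.yes _ | Relation.Nullary.yes _ = refl
  ... | Relation.Nullary.no _  | Relation.Nullary.no _  = refl
  ... | Relation.Nullary.yes p | Relation.Nullary.no q = Data.Empty.⊥-elim (q (Relation.Binary.PropositionalEquality.sym p))
    where import Data.Empty
  ... | Relation.Nullary.no p  | Relation.Nullary.yes q = Data.Empty.⊥-elim (p (Relation.Binary.PropositionalEquality.sym q))
    where import Data.Empty

  ≟-refl : ∀ {n} (u : Fin n) → ⌊ u ≟ u ⌋ ≡ true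
  ≟-refl u with u ≟ u
  ... | Relation.Nullary.yes _ = refl
  ... | Relation.Nullary.no p = Data.Empty.⊥-elim (p refl)
    where import Data.Empty

  ∧-false : ∀ b → b ∧ false ≡ false
  ∧-false true = refl
  ∧-false false = refl

complement : ∀ {n} → Graph n → Graph n
complement G = record
  { adj     = λ u v → not (adj G u v) ∧ not ⌊ u ≟ v ⌋
  ; adj-sym = λ u v → Relation.Binary.PropositionalEquality.cong₂ (λ a b → not a ∧ not b) (adj-sym G u v) (≟-sym u v)
  ; irrefl  = λ u → Relation.Binary.PropositionalEquality.trans
                (cong (λ b → not (adj G u u) ∧ not b) (≟-refl u)) (∧-false _)
  }

Adj : ∀ {n} → Graph n → Fin n → Fin n → Set
Adj G u v = adj G u v ≡ true

IsClique : ∀ {n} → Graph n → Subset n → Set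
IsClique G S = ∀ u v → u ∈ S → v ∈ S → u ≢ v → Adj G u v

IsMaximalClique : ∀ {n} → Graph n → Subset n → Set
IsMaximalClique G S = IsClique G S × (∀ T → IsClique G T → S ⊆ T → T ≡ S)

IsIndependent : ∀ {n} → Graph n → Subset n → Set
IsIndependent G S = ∀ u v → u ∈ S → v ∈ S → adj G u v ≡ false

IsMaximalIndependent : ∀ {n} → Graph n → Subset n → Set
IsMaximalIndependent G S = IsIndependent G S × (∀ T → IsIndependent G T → S ⊆ T → T ≡ S)

AtMostTwoMaxIndep : ∀ {n} → Graph n → Set
AtMostTwoMaxIndep G = ∀ v S₁ S₂ S₃ →
  IsMaximalIndependent G S₁ → IsMaximalIndependent G S₂ → IsMaximalIndependent G S₃ →
  v ∈ S₁ → v ∈ S₂ → v ∈ S₃ →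
  S₁ ≡ S₂ ⊎ S₁ ≡ S₃ ⊎ S₂ ≡ S₃

CycAdj : (k : ℕ) → Fin k → Fin k → Set
CycAdj k i j = suc (toℕ i) ≡ toℕ j ⊎ suc (toℕ j) ≡ toℕ i
             ⊎ (toℕ i ≡ 0 × suc (toℕ j) ≡ k) ⊎ (toℕ j ≡ 0 × suc (toℕ i) ≡ k)

IsCycle : ∀ {n} → Graph n → (k : ℕ) → (Fin k → Fin n) → Set
IsCycle G k c = 3 ≤ k × Injective _≡_ _≡_ c × (∀ i j → CycAdj k i j → Adj G (c i) (c j))

IsInducedCycle : ∀ {n} → Graph n → (k : ℕ) → (Fin k → Fin n) → Set
IsInducedCycle G k c = IsCycle G k c × (∀ i j → Adj G (c i) (c j) → CycAdj k i j)

IsChordal : ∀ {n} → Graph n → Set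
IsChordal {n} G = ∀ k (c : Fin k → Fin n) → 4 ≤ k → ¬ IsInducedCycle G k c

IsCoChordal : ∀ {n} → Graph n → Set
IsCoChordal G = IsChordal (complement G)

record Path {m : ℕ} (T : Graph m) : Set where
  field
    len   : ℕ
    vs    : Fin (suc len) → Fin m
    inj   : Injective _≡_ _≡_ vs
    steps : ∀ (i : Fin len) → Adj T (vs (inject₁ i)) (vs (fsuc i))
open Path public

start end : ∀ {m} {T : Graph m} → Path T → Fin m
start p = vs p fzero
end   p = vs p (fromℕ (len p))

IsConnected : ∀ {m} → Graph m → Set
IsConnected T = ∀ a b → Σ (Path T) λ p → start p ≡ a × end p ≡ b

IsAcyclic : ∀ {m} → Graph m → Set
IsAcyclic {m} T = ∀ k (c : Fin k → Fin m) → ¬ IsCycle T k c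

IsTree : ∀ {m} → Graph m → Set
IsTree T = IsConnected T × IsAcyclic T

record CliqueTree {n : ℕ} (H : Graph n) : Set where
  field
    m       : ℕ
    tree    : Graph m
    isTree  : IsTree tree
    K       : Fin m → Subset n
    K-inj   : Injective _≡_ _≡_ K
    K-max   : ∀ i → IsMaximalClique H (K i)
    K-onto  : ∀ S → IsMaximalClique H S → ∃[ i ] K i ≡ S
    K-inter : ∀ i j → i ≢ j → (p : Path tree) → start p ≡ i → end p ≡ j →
              ∀ l → (K i ∩ K j) ⊆ K (vs p l)
open CliqueTree public

-- Edge rankings of a tree.  A labelling φ is given on ordered pairs and
-- required to be symmetric on edges; values of edges lie in {1,…,r}.

SameEdge : ∀ {m} → Fin m → Fin m → Fin m → Fin m → Set
SameEdge a b c d = (a ≡ c × b ≡ d) ⊎ (a ≡ d × b ≡ c)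

edgeL edgeR : ∀ {m} {T : Graph m} (p : Path T) → Fin (len p) → Fin m
edgeL p i = vs p (inject₁ i)
edgeR p i = vs p (fsuc i)

IsEdgeRanking : ∀ {m} → Graph m → (r : ℕ) → (Fin m → Fin m → ℕ) → Set
IsEdgeRanking {m} T r φ =
    (∀ a b → Adj T a b → φ a b ≡ φ b a)
  × (∀ a b → Adj T a b → 1 ≤ φ a b × φ a b ≤ r)
  × (∀ a b c d → Adj T a b → Adj T c d → ¬ SameEdge a b c d → φ a b ≡ φ c d →
       -- on the path between the two edges some edge has larger rank
       (p : Path T) (i j : Fin (len p)) →
       SameEdge (edgeL p i) (edgeR p i) a b → SameEdge (edgeL p j) (edgeR p j) c d →
       ∃[ l ] ((toℕ i ≤ toℕ l × toℕ l ≤ toℕ j) ⊎ (toℕ j ≤ toℕ l × toℕ l ≤ toℕ i))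
              × φ a b < φ (edgeL p l) (edgeR p l))

IsBiclique : ∀ {n} → Graph n → Subset n × Subset n → Set
IsBiclique G (A , B) = (∀ v → v ∈ A → v ∉ B) × (∀ u v → u ∈ A → v ∈ B → Adj G u v)

CoversEdge : ∀ {n} → Subset n × Subset n → Fin n → Fin n → Set
CoversEdge (A , B) u v = (u ∈ A × v ∈ B) ⊎ (v ∈ A × u ∈ B)

IsBicliqueCover : ∀ {n} → Graph n → List (Subset n × Subset n) → Set
IsBicliqueCover G C = All (IsBiclique G) C × (∀ u v → Adj G u v → Any (λ X → CoversEdge X u v) C)

{-# OPTIONS --safe #-}
-- Root the clique tree and, for every rank k, let σ k x be the parity of the number of rank-k
-- edges on the tree path from the node x to the root, so that crossing a tree edge flips σ k
-- exactly when that edge has rank k.  The k-th biclique consists of the vertices all of whose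
-- nodes (maximal cliques of G^c containing them) have σ k = false, against those all of whose
-- nodes have σ k = true; it is complete bipartite because two non-adjacent vertices of G lie in a
-- common maximal clique of G^c.  For an edge uv of G, the at most two nodes containing u and the
-- at most two containing v are pairwise distinct and lie, in this order, on one tree path.  The
-- highest-ranked edge strictly between the last u-node and the first v-node is, by the ranking
-- property, the only edge of its rank on the whole path, so its rank separates u from v.
module Submission where

open import Defs
open import Data.Nat using (ℕ; zero; suc; pred; _+_; _≤_; _<_; z≤n; s≤s; _<?_; _≤?_)
open import Data.Nat.Properties
  using (≤-refl; ≤-trans; ≤-reflexive; <-≤-trans; ≤-<-trans; <-asym; <-irrefl; ≤∧≢⇒<;
         m<n⇒m<1+n; ≤⇒≯; <⇒≱; m≤m+n; n≤1+n; +-suc; +-identityʳ)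
  renaming (_≟_ to _≟ℕ_)
open import Data.Fin using (Fin; toℕ; inject₁; fromℕ; fromℕ<) renaming (zero to fzero; suc to fsuc)
open import Data.Fin.Properties
  using (_≟_; any?; all?; toℕ-inject₁; toℕ-fromℕ<; toℕ<n; inject₁-injective; toℕ-injective)
open import Data.Fin.Induction using (<-weakInduction)
open import Data.Fin.Subset using (Subset; _∈_; _∉_; _⊆_; _∪_; ⁅_⁆) renaming (⊥ to ∅)
open import Data.Fin.Subset.Properties
  using (_∈?_; x∈⁅x⁆; x∈⁅y⁆⇒x≡y; x∈p∪q⁻; x∈p∪q⁺; x∈p∩q⁺; p⊆p∪q; ⊆-antisym; ∉⊥)
open import Data.Bool using (Bool; true; false; not; _xor_)
import Data.Bool.Properties as Bool
open import Data.Bool.Properties using (xor-assoc; xor-same; xor-identityʳ; xor-comm; true-xor)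
import Data.Vec as Vec
open import Data.Vec.Properties using (lookup∘tabulate; []=⇒lookup; lookup⇒[]=)
open import Data.List
  using (List; []; _∷_; _++_; _∷ʳ_; length; lookup; tabulate; reverse; filter; allFin; foldl; applyUpTo)
open import Data.List.Properties
  using (unfold-reverse; reverse-++; ++-assoc; length-++; length-reverse; length-applyUpTo)
open import Data.List.Membership.Propositional using (lose) renaming (_∈_ to _∈ₗ_; _∉_ to _∉ₗ_)
open import Data.List.Membership.Propositional.Properties
  using (∈-++⁺ˡ; ∈-++⁺ʳ; ∈-++⁻; ∈-∃++; ∈-lookup; ∈-filter⁺; ∈-allFin)
import Data.List.Membership.DecPropositional as DecMembership
open import Data.List.Relation.Unary.Any using (Any; here; there)
import Data.List.Relation.Unary.Any as Any
open import Data.List.Relation.Unary.Any.Properties using (reverse⁺; reverse⁻; lookup-index; applyUpTo⁺)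
open import Data.List.Relation.Unary.All using (All; []; _∷_)
  renaming (lookup to All-lookup; map to All-map; tabulate to All-tabulate)
import Data.List.Relation.Unary.All.Properties as All
open import Data.List.Relation.Unary.AllPairs using ([]; _∷_)
import Data.List.Relation.Unary.AllPairs as AllPairs
open import Data.List.Relation.Unary.Linked using (Linked; []; [-]; _∷_)
import Data.List.Relation.Unary.Linked as Linked
import Data.List.Relation.Unary.Unique.Propositional as UniqueP
import Data.List.Relation.Unary.Unique.Propositional.Properties as Unique
open import Data.List.Extrema.Nat using (argmax; argmax-all; f[xs]≤f[argmax])
open import Data.Product using (Σ; _×_; _,_; proj₁; proj₂; ∃-syntax)
import Data.Product as Product
open import Data.Sum using (_⊎_; inj₁; inj₂)
import Data.Sum as Sum
open import Data.Empty using (⊥; ⊥-elim)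
open import Function using (_∘_; case_of_)
open import Function.Bundles using (_⇔_; mk⇔)
open import Level using (0ℓ)
open import Relation.Binary using (Rel; Symmetric)
open import Relation.Nullary using (¬_; Dec; yes; no; does)
open import Relation.Nullary.Decidable
  using (_→-dec_; _×-dec_; ¬?; dec-true; dec-false; does-⇔; isYes≗does)
open import Relation.Unary using (Pred; Decidable; ∁)
open import Relation.Binary.PropositionalEquality
  using (_≡_; _≢_; refl; sym; trans; cong; cong₂; subst; module ≡-Reasoning)

-- Lists as vertex sequences

module _ {a} {A : Set a} where

  open UniqueP {A = A} using (Unique)

  lastOf : A → List A → A
  lastOf x []       = x
  lastOf _ (y ∷ ys) = lastOf y ys

  lastOf-++ : ∀ x xs y ys → lastOf x (xs ++ y ∷ ys) ≡ lastOf y ys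
  lastOf-++ x []       y ys = refl
  lastOf-++ x (z ∷ xs) y ys = lastOf-++ z xs y ys

  lastOf-split : ∀ {x xs} pre {y ys} → x ∷ xs ≡ pre ++ y ∷ ys → lastOf x xs ≡ lastOf y ys
  lastOf-split []        refl = refl
  lastOf-split (p ∷ pre) refl = lastOf-++ p pre _ _

  lastOf-∈ : ∀ x xs → lastOf x xs ∈ₗ x ∷ xs
  lastOf-∈ x []       = here refl
  lastOf-∈ x (y ∷ ys) = there (lastOf-∈ y ys)

  lastOf-reverse : ∀ (c q : A) qs → lastOf c (reverse (q ∷ qs)) ≡ q
  lastOf-reverse c q qs rewrite unfold-reverse q qs = lastOf-++ c (reverse qs) q []

  length-++-∷ : ∀ (xs : List A) {y ys} → 1 ≤ length (xs ++ y ∷ ys)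
  length-++-∷ []      = s≤s z≤n
  length-++-∷ (_ ∷ _) = s≤s z≤n

  lastOf-tabulate : ∀ {l} (f : Fin (suc l) → A) →
                    lastOf (f fzero) (tabulate (λ i → f (fsuc i))) ≡ f (fromℕ l)
  lastOf-tabulate {zero}  f = refl
  lastOf-tabulate {suc l} f = lastOf-tabulate (λ i → f (fsuc i))

  lookup-last : ∀ x xs (j : Fin (suc (length xs))) → toℕ j ≡ length xs → lookup (x ∷ xs) j ≡ lastOf x xs
  lookup-last x []       fzero    _  = refl
  lookup-last x (y ∷ ys) (fsuc j) eq = lookup-last y ys j (cong pred eq)

  module _ {ℓ} {R : Rel A ℓ} where

    Linked-cut : ∀ xs {y ys} → Linked R (xs ++ y ∷ ys) → Linked R (xs ∷ʳ y)
    Linked-cut []           _           = [-]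
    Linked-cut (x ∷ [])     (r ∷ _)     = r ∷ [-]
    Linked-cut (x ∷ x′ ∷ xs) (r ∷ rs)   = r ∷ Linked-cut (x′ ∷ xs) rs

    Linked-++⁻ʳ : ∀ xs {ys} → Linked R (xs ++ ys) → Linked R ys
    Linked-++⁻ʳ []            rs       = rs
    Linked-++⁻ʳ (x ∷ [])      [-]      = []
    Linked-++⁻ʳ (x ∷ [])      (_ ∷ rs) = rs
    Linked-++⁻ʳ (x ∷ x′ ∷ xs) (_ ∷ rs) = Linked-++⁻ʳ (x′ ∷ xs) rs

    Linked-join : ∀ xs {y ys} → Linked R (xs ∷ʳ y) → Linked R (y ∷ ys) → Linked R (xs ++ y ∷ ys)
    Linked-join []            _        rs = rs
    Linked-join (x ∷ [])      (r ∷ _)  rs = r ∷ rs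
    Linked-join (x ∷ x′ ∷ xs) (r ∷ r′) rs = r ∷ Linked-join (x′ ∷ xs) r′ rs

    Linked-∷ʳ : ∀ xs {y z} → Linked R (xs ∷ʳ y) → R y z → Linked R (xs ∷ʳ y ∷ʳ z)
    Linked-∷ʳ []            [-]      r = r ∷ [-]
    Linked-∷ʳ (x ∷ [])      (r′ ∷ _) r = r′ ∷ r ∷ [-]
    Linked-∷ʳ (x ∷ x′ ∷ xs) (r′ ∷ rs) r = r′ ∷ Linked-∷ʳ (x′ ∷ xs) rs r

    Linked-reverse : Symmetric R → ∀ {xs} → Linked R xs → Linked R (reverse xs)
    Linked-reverse sym-R [] = []
    Linked-reverse sym-R [-] = [-]
    Linked-reverse sym-R {x ∷ y ∷ xs} (r ∷ rs)
      rewrite unfold-reverse x (y ∷ xs) | unfold-reverse y xs =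
        Linked-∷ʳ (reverse xs) rev (sym-R r)
      where
      rev : Linked R (reverse xs ++ y ∷ [])
      rev = subst (Linked R) (unfold-reverse y xs) (Linked-reverse sym-R rs)

    Linked-reverse-join : Symmetric R → ∀ {x xs ys} → Linked R (x ∷ xs) → Linked R (x ∷ ys) →
                          Linked R (reverse (x ∷ xs) ++ ys)
    Linked-reverse-join sym-R {x} {xs} {ys} lx ly
      rewrite unfold-reverse x xs | ++-assoc (reverse xs) (x ∷ []) ys =
        Linked-join (reverse xs) (subst (Linked R) (unfold-reverse x xs) (Linked-reverse sym-R lx)) ly

    Linked-lookup : ∀ {xs} → Linked R xs → ∀ (i : Fin (length xs)) j → suc (toℕ i) ≡ toℕ j →
                    R (lookup xs i) (lookup xs j)
    Linked-lookup (r ∷ rs) fzero    (fsuc fzero) refl = r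
    Linked-lookup (r ∷ rs) (fsuc i) (fsuc j)     eq   = Linked-lookup rs i j (cong pred eq)

    Linked-tabulate : ∀ {l} (f : Fin (suc l) → A) → (∀ (i : Fin l) → R (f (inject₁ i)) (f (fsuc i))) →
                      Linked R (tabulate f)
    Linked-tabulate {zero}  f steps = [-]
    Linked-tabulate {suc l} f steps =
      steps fzero ∷ Linked-tabulate (λ i → f (fsuc i)) (λ i → steps (fsuc i))

  Unique-++⁻ˡ : ∀ xs {ys} → Unique (xs ++ ys) → Unique xs
  Unique-++⁻ˡ []       _          = []
  Unique-++⁻ˡ (x ∷ xs) (d ∷ ds)   = All.++⁻ˡ xs d ∷ Unique-++⁻ˡ xs ds

  Unique-++⁻ʳ : ∀ xs {ys} → Unique (xs ++ ys) → Unique ys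
  Unique-++⁻ʳ []       ds       = ds
  Unique-++⁻ʳ (x ∷ xs) (_ ∷ ds) = Unique-++⁻ʳ xs ds

  Unique-reverse : ∀ {xs} → Unique xs → Unique (reverse xs)
  Unique-reverse [] = []
  Unique-reverse {x ∷ xs} (x∉xs ∷ ds) rewrite unfold-reverse x xs =
    Unique.++⁺ (Unique-reverse ds) ([] ∷ [])
      λ { (x∈ , here refl) → All.All¬⇒¬Any x∉xs (reverse⁻ x∈) }

  Unique-lookup-injective : ∀ {xs} → Unique xs → ∀ {i j} → lookup xs i ≡ lookup xs j → i ≡ j
  Unique-lookup-injective (_ ∷ _)   {fzero}  {fzero}  _  = refl
  Unique-lookup-injective (d ∷ _)   {fzero}  {fsuc j} eq =
    ⊥-elim (All.All¬⇒¬Any d (subst (_∈ₗ _) (sym eq) (∈-lookup j)))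
  Unique-lookup-injective (d ∷ _)   {fsuc i} {fzero}  eq =
    ⊥-elim (All.All¬⇒¬Any d (subst (_∈ₗ _) eq (∈-lookup i)))
  Unique-lookup-injective (_ ∷ ds)  {fsuc i} {fsuc j} eq = cong fsuc (Unique-lookup-injective ds eq)

  module _ {p} {P : Pred A p} (P? : Decidable P) where

    firstSplit : ∀ {xs} → Any P xs →
                 ∃[ pre ] ∃[ y ] ∃[ ys ] (xs ≡ pre ++ y ∷ ys × All (∁ P) pre × P y)
    firstSplit {x ∷ xs} pxs with P? x | pxs
    ... | yes px | _         = [] , x , xs , refl , [] , px
    ... | no ¬px | here px   = ⊥-elim (¬px px)
    ... | no ¬px | there pxs′ with firstSplit pxs′
    ...   | pre , y , ys , refl , ¬pre , py = x ∷ pre , y , ys , refl , ¬px ∷ ¬pre , py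

    lastSplit : ∀ {xs} → Any P xs →
                ∃[ pre ] ∃[ y ] ∃[ ys ] (xs ≡ pre ++ y ∷ ys × P y × All (∁ P) ys)
    lastSplit {x ∷ xs} pxs with Any.any? P? xs | pxs
    ... | yes pxs′ | _ with lastSplit pxs′
    ...   | pre , y , ys , refl , py , ¬ys = x ∷ pre , y , ys , refl , py , ¬ys
    lastSplit {x ∷ xs} pxs | no ¬pxs′ | here px   = [] , x , xs , refl , px , All.¬Any⇒All¬ xs ¬pxs′
    lastSplit {x ∷ xs} pxs | no ¬pxs′ | there pxs′ = ⊥-elim (¬pxs′ pxs′)

  position-in-prefix : ∀ {xs} (ys : List A) {z} → z ∈ₗ xs →
                       ∃[ s ] (lookup (xs ++ ys) s ≡ z × toℕ s < length xs)
  position-in-prefix ys (here refl) = fzero , refl , s≤s z≤n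
  position-in-prefix ys (there z∈) with position-in-prefix ys z∈
  ... | s , at , bound = fsuc s , at , s≤s bound

  position-in-suffix : ∀ (xs ys : List A) {zs z} → z ∈ₗ zs →
                       ∃[ s ] (lookup (xs ++ ys ++ zs) s ≡ z × length xs + length ys ≤ toℕ s)
  position-in-suffix []       []       z∈ = Any.index z∈ , sym (lookup-index z∈) , z≤n
  position-in-suffix []       (_ ∷ ys) z∈ with position-in-suffix [] ys z∈
  ... | s , at , bound = fsuc s , at , s≤s bound
  position-in-suffix (_ ∷ xs) ys       z∈ with position-in-suffix xs ys z∈
  ... | s , at , bound = fsuc s , at , s≤s bound

  All-disjoint : ∀ {p} {P : Pred A p} {xs ys} → All P xs → All (∁ P) ys → ∀ {z} → ¬ (z ∈ₗ xs × z ∈ₗ ys)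
  All-disjoint pxs ¬pys (z∈xs , z∈ys) = All-lookup ¬pys z∈ys (All-lookup pxs z∈xs)

-- Paths in trees

module _ {m} (T : Graph m) where

  open UniqueP {A = Fin m} using (Unique)

  Adj-sym : ∀ {a b} → Adj T a b → Adj T b a
  Adj-sym {a} {b} e = trans (adj-sym T b a) e

  Adj-irrefl : ∀ {a} → ¬ Adj T a a
  Adj-irrefl {a} e with trans (sym e) (irrefl T a)
  ... | ()

  record Route (x z : Fin m) : Set where
    constructor route
    field
      hops    : List (Fin m)
      linked  : Linked (Adj T) (x ∷ hops)
      unique  : Unique (x ∷ hops)
      arrives : lastOf x hops ≡ z
  open Route public using (hops)

  pathRoute : (p : Path T) → Route (start p) (end p)
  pathRoute p = route (tabulate (λ i → vs p (fsuc i))) (Linked-tabulate (vs p) (steps p))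
                      (Unique.tabulate⁺ (inj p)) (lastOf-tabulate (vs p))

  connected⇒route : IsConnected T → ∀ x z → Route x z
  connected⇒route connected x z with connected x z
  ... | p , refl , refl = pathRoute p

  listPath : ∀ x xs → Linked (Adj T) (x ∷ xs) → Unique (x ∷ xs) → Path T
  listPath x xs linked unique = record
    { len   = length xs
    ; vs    = lookup (x ∷ xs)
    ; inj   = Unique-lookup-injective unique
    ; steps = λ i → Linked-lookup linked (inject₁ i) (fsuc i) (cong suc (toℕ-inject₁ i))
    }

  closed-route⇒cycle : ∀ {x xs} → Linked (Adj T) (x ∷ xs) → Unique (x ∷ xs) → 2 ≤ length xs →
                       Adj T (lastOf x xs) x → IsCycle T (suc (length xs)) (lookup (x ∷ xs))
  closed-route⇒cycle {x} {xs} linked unique long closing =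
    s≤s long , Unique-lookup-injective unique , adjacent
    where
    adjacent : ∀ i j → CycAdj (suc (length xs)) i j → Adj T (lookup (x ∷ xs) i) (lookup (x ∷ xs) j)
    adjacent i j (inj₁ i→j)                      = Linked-lookup linked i j i→j
    adjacent i j (inj₂ (inj₁ j→i))               = Adj-sym (Linked-lookup linked j i j→i)
    adjacent fzero j (inj₂ (inj₂ (inj₁ (_ , jlast)))) =
      subst (Adj T x) (sym (lookup-last x xs j (cong pred jlast))) (Adj-sym closing)
    adjacent i fzero (inj₂ (inj₂ (inj₂ (_ , ilast)))) =
      subst (λ w → Adj T w x) (sym (lookup-last x xs i (cong pred ilast))) closing

module _ {m} {T : Graph m} (acyclic : IsAcyclic T) where

  open UniqueP {A = Fin m} using (Unique)
  open DecMembership (_≟_ {n = m}) using () renaming (_∈?_ to _∈ₗ?_)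

  -- Out from b along the first path to c, its first vertex on the second path, and back to b along
  -- the second path: as pre avoids the second path, this closed walk repeats no vertex.
  fork-cycle : ∀ {b} pre c rest qpre ys →
    Linked (Adj T) (b ∷ pre ++ c ∷ rest) → Unique (b ∷ pre ++ c ∷ rest) →
    Linked (Adj T) (b ∷ qpre ++ c ∷ ys) → Unique (b ∷ qpre ++ c ∷ ys) →
    All (_∉ₗ qpre ++ c ∷ ys) pre → 2 ≤ length (pre ++ c ∷ reverse qpre) → ⊥
  fork-cycle {b} pre c rest qpre ys lX (b∉X ∷ uX) lY (b∉Y ∷ uY) pre∉Y long =
    acyclic _ (lookup (b ∷ pre ++ back)) (closed-route⇒cycle T linked unique long closing)
    where
    back : List (Fin m)
    back = c ∷ reverse qpre

    back≡ : reverse (qpre ∷ʳ c) ≡ back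
    back≡ = reverse-++ qpre (c ∷ [])

    linked : Linked (Adj T) (b ∷ pre ++ back)
    linked = Linked-join (b ∷ pre) (Linked-cut (b ∷ pre) lX) (subst (Linked (Adj T)) back≡ returning)
      where
      returning : Linked (Adj T) (reverse (qpre ∷ʳ c))
      returning = Linked-reverse (Adj-sym T) (Linked-cut qpre (Linked.tail lY))

    back⊆Y : ∀ {z} → z ∈ₗ back → z ∈ₗ qpre ++ c ∷ ys
    back⊆Y (here refl) = ∈-++⁺ʳ qpre (here refl)
    back⊆Y (there z∈) = ∈-++⁺ˡ (reverse⁻ {xs = qpre} z∈)

    unique : Unique (b ∷ pre ++ back)
    unique = All.¬Any⇒All¬ (pre ++ back) b∉ ∷ Unique.++⁺ (Unique-++⁻ˡ pre uX) (subst Unique back≡ returning)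
               λ { (z∈pre , z∈back) → All-lookup pre∉Y z∈pre (back⊆Y z∈back) }
      where
      returning : Unique (reverse (qpre ∷ʳ c))
      returning = Unique-reverse (Unique-++⁻ˡ (qpre ∷ʳ c) (subst Unique (sym (++-assoc qpre (c ∷ []) ys)) uY))
      b∉ : b ∉ₗ pre ++ back
      b∉ b∈ with ∈-++⁻ pre b∈
      ... | inj₁ b∈pre  = All.All¬⇒¬Any b∉X (∈-++⁺ˡ b∈pre)
      ... | inj₂ b∈back = All.All¬⇒¬Any b∉Y (back⊆Y b∈back)

    closing : Adj T (lastOf b (pre ++ back)) b
    closing rewrite lastOf-++ b pre c (reverse qpre) = Adj-sym T (last-back qpre lY)
      where
      last-back : ∀ qpre → Linked (Adj T) (b ∷ qpre ++ c ∷ ys) → Adj T b (lastOf c (reverse qpre))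
      last-back []         (e ∷ _) = e
      last-back (q ∷ qpre) (e ∷ _) = subst (Adj T b) (sym (lastOf-reverse c q qpre)) e

  no-fork : ∀ {b a a′ ps qs} → a ≢ a′ →
    Linked (Adj T) (b ∷ a ∷ ps) → Unique (b ∷ a ∷ ps) →
    Linked (Adj T) (b ∷ a′ ∷ qs) → Unique (b ∷ a′ ∷ qs) → lastOf a ps ≡ lastOf a′ qs → ⊥
  no-fork {b} {a} {a′} {ps} {qs} a≢a′ lX uX lY uY same
    with firstSplit (_∈ₗ? a′ ∷ qs) (lose (lastOf-∈ a ps) (subst (_∈ₗ a′ ∷ qs) (sym same) (lastOf-∈ a′ qs)))
  ... | pre , c , rest , eqX , pre∉Y , c∈Y with ∈-∃++ c∈Y
  ... | qpre , ys , eqY =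
    fork-cycle pre c rest qpre ys
      (subst (λ X → Linked (Adj T) (b ∷ X)) eqX lX) (subst (λ X → Unique (b ∷ X)) eqX uX)
      (subst (λ Y → Linked (Adj T) (b ∷ Y)) eqY lY) (subst (λ Y → Unique (b ∷ Y)) eqY uY)
      (subst (λ Y → All (_∉ₗ Y) pre) eqY pre∉Y) (long pre qpre eqX eqY)
    where
    long : ∀ pre qpre → a ∷ ps ≡ pre ++ c ∷ rest → a′ ∷ qs ≡ qpre ++ c ∷ ys →
           2 ≤ length (pre ++ c ∷ reverse qpre)
    long []      []       refl refl = ⊥-elim (a≢a′ refl)
    long []      (q ∷ qs) _    _ rewrite unfold-reverse q qs = s≤s (length-++-∷ (reverse qs))
    long (p ∷ pre) qpre   _    _ = s≤s (length-++-∷ pre)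

  hops-unique : ∀ {x} ps qs → Linked (Adj T) (x ∷ ps) → Unique (x ∷ ps) →
                Linked (Adj T) (x ∷ qs) → Unique (x ∷ qs) → lastOf x ps ≡ lastOf x qs → ps ≡ qs
  hops-unique []       []       _  _          _  _          _    = refl
  hops-unique []       (q ∷ qs) _  _          _  (x∉ ∷ _)   same =
    ⊥-elim (All.All¬⇒¬Any x∉ (subst (_∈ₗ q ∷ qs) (sym same) (lastOf-∈ q qs)))
  hops-unique (p ∷ ps) []       _  (x∉ ∷ _)   _  _          same =
    ⊥-elim (All.All¬⇒¬Any x∉ (subst (_∈ₗ p ∷ ps) same (lastOf-∈ p ps)))
  hops-unique (p ∷ ps) (q ∷ qs) lp up         lq uq         same with p ≟ q
  ... | yes refl =
    cong (p ∷_) (hops-unique ps qs (Linked.tail lp) (AllPairs.tail up) (Linked.tail lq) (AllPairs.tail uq) same)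
  ... | no p≢q = ⊥-elim (no-fork p≢q lp up lq uq same)

  route-unique : ∀ {x z} (p q : Route T x z) → hops p ≡ hops q
  route-unique (route ps lp up ep) (route qs lq uq eq) =
    hops-unique ps qs lp up lq uq (trans ep (sym eq))

module Parity {m} {T : Graph m} (tree : IsTree T) (root : Fin m)
              (φ : Fin m → Fin m → ℕ) (φ-sym : ∀ a b → Adj T a b → φ a b ≡ φ b a) where

  open UniqueP {A = Fin m} using (Unique)
  open DecMembership (_≟_ {n = m}) using () renaming (_∈?_ to _∈ₗ?_)

  parity : ℕ → List (Fin m) → Bool
  parity k (x ∷ y ∷ ys) = does (φ x y ≟ℕ k) xor parity k (y ∷ ys)
  parity k _            = false

  opaque
    rootRoute : ∀ x → Route T x root
    rootRoute x = connected⇒route T (proj₁ tree) x root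

  σ : ℕ → Fin m → Bool
  σ k x = parity k (x ∷ hops (rootRoute x))

  rootRoutes-adjacent : ∀ {x y} → Adj T x y →
    hops (rootRoute x) ≡ y ∷ hops (rootRoute y) ⊎ hops (rootRoute y) ≡ x ∷ hops (rootRoute x)
  rootRoutes-adjacent {x} {y} xy with rootRoute x | rootRoute y
  ... | route xs lx (x∉xs ∷ uxs) ex | Y with y ∈ₗ? xs
  ...   | yes y∈xs with ∈-∃++ y∈xs
  ...     | pre , suf , refl = inj₁ (trans (unique (route xs lx (x∉xs ∷ uxs) ex) viaY)
                                           (cong (y ∷_) (unique fromY Y)))
    where
    unique : ∀ {z} (p q : Route T z root) → hops p ≡ hops q
    unique = route-unique (proj₂ tree)
    suf-linked : Linked (Adj T) (y ∷ suf)
    suf-linked = Linked-++⁻ʳ pre (Linked.tail lx)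
    suf-arrives : lastOf y suf ≡ root
    suf-arrives = trans (sym (lastOf-++ x pre y suf)) ex
    fromY : Route T y root
    fromY = route suf suf-linked (Unique-++⁻ʳ pre uxs) suf-arrives
    viaY : Route T x root
    viaY = route (y ∷ suf) (xy ∷ suf-linked) (All.++⁻ʳ pre x∉xs ∷ Unique-++⁻ʳ pre uxs) suf-arrives
  rootRoutes-adjacent {x} {y} xy | route xs lx (x∉xs ∷ uxs) ex | Y | no y∉xs =
    inj₂ (route-unique (proj₂ tree) Y viaX)
    where
    y≢x : y ≢ x
    y≢x refl = Adj-irrefl T xy
    viaX : Route T y root
    viaX = route (x ∷ xs) (Adj-sym T xy ∷ lx) ((y≢x ∷ All.¬Any⇒All¬ xs y∉xs) ∷ x∉xs ∷ uxs) ex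

  σ-step : ∀ k {x y} → Adj T x y → σ k y ≡ does (φ x y ≟ℕ k) xor σ k x
  σ-step k {x} {y} xy with rootRoutes-adjacent xy
  ... | inj₁ x-via-y = begin
    σ k y                ≡⟨ cong (_xor σ k y) (xor-same d) ⟨
    (d xor d) xor σ k y  ≡⟨ xor-assoc d d (σ k y) ⟩
    d xor (d xor σ k y)  ≡⟨ cong (λ h → d xor parity k (x ∷ h)) x-via-y ⟨
    d xor σ k x          ∎
    where
    open ≡-Reasoning
    d : Bool
    d = does (φ x y ≟ℕ k)
  ... | inj₂ y-via-x = begin
    σ k y                         ≡⟨ cong (λ h → parity k (y ∷ h)) y-via-x ⟩
    does (φ y x ≟ℕ k) xor σ k x   ≡⟨ cong (λ w → does (w ≟ℕ k) xor σ k x) (φ-sym y x (Adj-sym T xy)) ⟩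
    does (φ x y ≟ℕ k) xor σ k x   ∎
    where open ≡-Reasoning

-- Cliques

module _ {n} (H : Graph n) where

  isClique? : ∀ S → Dec (IsClique H S)
  isClique? S = all? λ u → all? λ v →
    (u ∈? S) →-dec ((v ∈? S) →-dec (¬? (u ≟ v) →-dec (adj H u v Bool.≟ true)))

  IsClique-⊆ : ∀ {S C} → IsClique H C → S ⊆ C → IsClique H S
  IsClique-⊆ clique S⊆C u v u∈ v∈ = clique u v (S⊆C u∈) (S⊆C v∈)

  ∈-pair⁻ : ∀ {x u v : Fin n} → x ∈ ⁅ u ⁆ ∪ ⁅ v ⁆ → x ≡ u ⊎ x ≡ v
  ∈-pair⁻ = Sum.map (x∈⁅y⁆⇒x≡y _) (x∈⁅y⁆⇒x≡y _) ∘ x∈p∪q⁻ _ _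

  singleton-isClique : ∀ u → IsClique H ⁅ u ⁆
  singleton-isClique u x y x∈ y∈ x≢y = ⊥-elim (x≢y (trans (x∈⁅y⁆⇒x≡y u x∈) (sym (x∈⁅y⁆⇒x≡y u y∈))))

  pair-isClique : ∀ {u v} → Adj H u v → IsClique H (⁅ u ⁆ ∪ ⁅ v ⁆)
  pair-isClique uv x y x∈ y∈ x≢y with ∈-pair⁻ x∈ | ∈-pair⁻ y∈
  ... | inj₁ refl | inj₁ refl = ⊥-elim (x≢y refl)
  ... | inj₁ refl | inj₂ refl = uv
  ... | inj₂ refl | inj₁ refl = Adj-sym H uv
  ... | inj₂ refl | inj₂ refl = ⊥-elim (x≢y refl)

  private
    extend : Subset n → Fin n → Subset n
    extend S v with isClique? (S ∪ ⁅ v ⁆)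
    ... | yes _ = S ∪ ⁅ v ⁆
    ... | no  _ = S

    extend-isClique : ∀ {S} v → IsClique H S → IsClique H (extend S v)
    extend-isClique {S} v clique with isClique? (S ∪ ⁅ v ⁆)
    ... | yes clique′ = clique′
    ... | no  _       = clique

    extend-⊇ : ∀ {S} v → S ⊆ extend S v
    extend-⊇ {S} v with isClique? (S ∪ ⁅ v ⁆)
    ... | yes _ = p⊆p∪q ⁅ v ⁆
    ... | no  _ = λ x∈ → x∈

    extend-∈ : ∀ {S C} v → IsClique H C → S ⊆ C → v ∈ C → v ∈ extend S v
    extend-∈ {S} {C} v clique S⊆C v∈C with isClique? (S ∪ ⁅ v ⁆)
    ... | yes _   = x∈p∪q⁺ (inj₂ (x∈⁅x⁆ v))
    ... | no  not = ⊥-elim (not (IsClique-⊆ clique added⊆C))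
      where
      added⊆C : S ∪ ⁅ v ⁆ ⊆ C
      added⊆C x∈ with x∈p∪q⁻ S ⁅ v ⁆ x∈
      ... | inj₁ x∈S = S⊆C x∈S
      ... | inj₂ x∈v rewrite x∈⁅y⁆⇒x≡y v x∈v = v∈C

    saturate : Subset n → List (Fin n) → Subset n
    saturate = foldl extend

    saturate-isClique : ∀ {S} vs → IsClique H S → IsClique H (saturate S vs)
    saturate-isClique []       clique = clique
    saturate-isClique (v ∷ vs) clique = saturate-isClique vs (extend-isClique v clique)

    saturate-⊇ : ∀ {S} vs → S ⊆ saturate S vs
    saturate-⊇ []       x∈ = x∈
    saturate-⊇ (v ∷ vs) x∈ = saturate-⊇ vs (extend-⊇ v x∈)

    saturate-∈ : ∀ {S C v} vs → v ∈ₗ vs → IsClique H C → saturate S vs ⊆ C → v ∈ C → v ∈ saturate S vs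
    saturate-∈ {S} (v ∷ vs) (here refl) clique sat⊆C v∈C =
      saturate-⊇ vs (extend-∈ v clique (sat⊆C ∘ saturate-⊇ vs ∘ extend-⊇ v) v∈C)
    saturate-∈ {S} (w ∷ vs) (there v∈) clique sat⊆C v∈C = saturate-∈ vs v∈ clique sat⊆C v∈C

  maximalClique-⊇ : ∀ {S} → IsClique H S → ∃[ M ] (IsMaximalClique H M × S ⊆ M)
  maximalClique-⊇ {S} clique =
    M , (saturate-isClique (allFin n) clique , maximal) , saturate-⊇ (allFin n)
    where
    M : Subset n
    M = saturate S (allFin n)
    maximal : ∀ C → IsClique H C → M ⊆ C → C ≡ M
    maximal C clique-C M⊆C =
      ⊆-antisym (λ {v} v∈C → saturate-∈ (allFin n) (∈-allFin v) clique-C M⊆C v∈C) M⊆C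

module _ {n} (G : Graph n) where

  complement-Adj⁺ : ∀ {u v} → adj G u v ≡ false → u ≢ v → Adj (complement G) u v
  complement-Adj⁺ {u} {v} nonadj u≢v rewrite nonadj =
    cong not (trans (isYes≗does (u ≟ v)) (dec-false (u ≟ v) u≢v))

  complement-Adj⁻ : ∀ {u v} → Adj (complement G) u v → adj G u v ≡ false
  complement-Adj⁻ {u} {v} adj-c with adj G u v | adj-c
  ... | false | _  = refl
  ... | true  | ()

  maximalClique⇒maximalIndependent : ∀ {S} → IsMaximalClique (complement G) S → IsMaximalIndependent G S
  maximalClique⇒maximalIndependent (clique , maximal) =
    clique⇒independent clique , λ I independent S⊆I → maximal I (independent⇒clique independent) S⊆I
    where
    clique⇒independent : ∀ {S} → IsClique (complement G) S → IsIndependent G S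
    clique⇒independent clique u v u∈ v∈ with u ≟ v
    ... | yes refl = irrefl G u
    ... | no  u≢v  = complement-Adj⁻ (clique u v u∈ v∈ u≢v)
    independent⇒clique : ∀ {S} → IsIndependent G S → IsClique (complement G) S
    independent⇒clique independent u v u∈ v∈ = complement-Adj⁺ (independent u v u∈ v∈)

⟦_⟧ : ∀ {n} {P : Pred (Fin n) 0ℓ} → Decidable P → Subset n
⟦ P? ⟧ = Vec.tabulate (does ∘ P?)

∈⟦⟧⁺ : ∀ {n} {P : Pred (Fin n) 0ℓ} (P? : Decidable P) {x} → P x → x ∈ ⟦ P? ⟧
∈⟦⟧⁺ P? {x} px = lookup⇒[]= x _ (trans (lookup∘tabulate _ x) (dec-true (P? x) px))

∈⟦⟧⁻ : ∀ {n} {P : Pred (Fin n) 0ℓ} (P? : Decidable P) {x} → x ∈ ⟦ P? ⟧ → P x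
∈⟦⟧⁻ P? {x} x∈ = dec-true⁻ (P? x) (trans (sym (lookup∘tabulate _ x)) ([]=⇒lookup x∈))
  where
  dec-true⁻ : ∀ {A : Set} (a? : Dec A) → does a? ≡ true → A
  dec-true⁻ (yes a) _ = a

-- Edge rankings

window-bounds : ∀ a b {c} → 1 ≤ c → c ≤ 2 → suc (a + b) ≤ a + (b + c) × a + (b + c) ≤ suc (suc (a + b))
window-bounds a b {1} _ _ rewrite +-suc b 0 | +-identityʳ b | +-suc a b = ≤-refl , n≤1+n _
window-bounds a b {2} _ _ rewrite +-suc b 1 | +-suc b 0 | +-identityʳ b | +-suc a (suc b) | +-suc a b =
  n≤1+n _ , ≤-refl
window-bounds a b {suc (suc (suc _))} _ (s≤s (s≤s ()))

module Ranking {m} {T : Graph m} (tree : IsTree T) (root : Fin m)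
               {r φ} (ranking : IsEdgeRanking T r φ) where

  open Parity tree root φ (proj₁ ranking)
  open UniqueP {A = Fin m} using (Unique)

  rank : (p : Path T) → Fin (len p) → ℕ
  rank p s = φ (edgeL p s) (edgeR p s)

  path-edges-distinct : (p : Path T) {s t : Fin (len p)} → s ≢ t →
                        ¬ SameEdge (edgeL p s) (edgeR p s) (edgeL p t) (edgeR p t)
  path-edges-distinct p s≢t (inj₁ (same , _)) = s≢t (inject₁-injective (inj p same))
  path-edges-distinct p {s} {t} _ (inj₂ (s≡t+1 , s+1≡t)) = <-asym t<s s<t
    where
    t<s : toℕ t < toℕ s
    t<s = ≤-reflexive (sym (trans (sym (toℕ-inject₁ s)) (cong toℕ (inj p s≡t+1))))
    s<t : toℕ s < toℕ t
    s<t = ≤-reflexive (trans (cong toℕ (inj p s+1≡t)) (toℕ-inject₁ t))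

  InWindow : ℕ → ℕ → ∀ {l} → Fin l → Set
  InWindow w β t = w ≤ toℕ t × toℕ t < β

  -- The window misses at most one edge at each end of the path, so the higher edge that the ranking
  -- puts between two edges of equal rank lies inside it.
  rank-unique-in-window : (p : Path T) {w β : ℕ} → w ≤ 1 → len p ≤ suc β →
    (t : Fin (len p)) → InWindow w β t → (∀ s → InWindow w β s → rank p s ≤ rank p t) →
    ∀ s → rank p s ≡ rank p t → s ≡ t
  rank-unique-in-window p {w} {β} w≤1 short t (w≤t , t<β) t-max s same with s ≟ t
  ... | yes s≡t = s≡t
  ... | no s≢t with proj₂ (proj₂ ranking) _ _ _ _ (steps p s) (steps p t) (path-edges-distinct p s≢t)
                      same p s t (inj₁ (refl , refl)) (inj₁ (refl , refl))
  ...   | l , between , higher =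
    ⊥-elim (<⇒≱ (subst (_< rank p l) same higher) (t-max l (in-window between)))
    where
    l≢s : toℕ l ≢ toℕ s
    l≢s l≡s with toℕ-injective l≡s
    ... | refl = <-irrefl refl higher
    in-window : (toℕ s ≤ toℕ l × toℕ l ≤ toℕ t) ⊎ (toℕ t ≤ toℕ l × toℕ l ≤ toℕ s) → InWindow w β l
    in-window (inj₁ (s≤l , l≤t)) =
      ≤-trans w≤1 (≤-<-trans z≤n (≤∧≢⇒< s≤l (λ s≡l → l≢s (sym s≡l)))) , ≤-<-trans l≤t t<β
    in-window (inj₂ (t≤l , l≤s)) = ≤-trans w≤t t≤l , <-≤-trans (≤∧≢⇒< l≤s l≢s) s≤β
      where
      s≤β : toℕ s ≤ β
      s≤β with ≤-trans (toℕ<n s) short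
      ... | s≤s s≤β = s≤β

  σ-along : ∀ k (p : Path T) (t : Fin (len p)) → rank p t ≡ k → (∀ s → rank p s ≡ k → s ≡ t) →
            ∀ x → σ k (vs p x) ≡ σ k (start p) xor does (toℕ t <? toℕ x)
  σ-along k p t t-rank only-t = <-weakInduction P base step
    where
    c : Bool
    c = σ k (start p)
    P : Fin (suc (len p)) → Set
    P x = σ k (vs p x) ≡ c xor does (toℕ t <? toℕ x)

    base : P fzero
    base = sym (trans (cong (c xor_) (dec-false (toℕ t <? 0) λ ())) (xor-identityʳ c))

    crossing : ∀ b → true xor (b xor false) ≡ b xor true
    crossing true  = refl
    crossing false = refl

    step : ∀ j → P (inject₁ j) → P (fsuc j)
    step j ih with j ≟ t
    ... | yes refl = begin
      σ k (vs p (fsuc t))                                ≡⟨ σ-step k (steps p t) ⟩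
      does (rank p t ≟ℕ k) xor σ k (vs p (inject₁ t))    ≡⟨ cong₂ _xor_ (dec-true (_ ≟ℕ k) t-rank) ih ⟩
      true xor (c xor does (toℕ t <? toℕ (inject₁ t)))   ≡⟨ cong (λ b → true xor (c xor b)) not-yet ⟩
      true xor (c xor false)                             ≡⟨ crossing c ⟩
      c xor true                                         ≡⟨ cong (c xor_) now ⟨
      c xor does (toℕ t <? suc (toℕ t))                  ∎
      where
      open ≡-Reasoning
      not-yet : does (toℕ t <? toℕ (inject₁ t)) ≡ false
      not-yet = dec-false (toℕ t <? _) (λ t<t → <-irrefl (sym (toℕ-inject₁ t)) t<t)
      now : does (toℕ t <? suc (toℕ t)) ≡ true
      now = dec-true (toℕ t <? _) ≤-refl
    ... | no j≢t = begin
      σ k (vs p (fsuc j))                                ≡⟨ σ-step k (steps p j) ⟩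
      does (rank p j ≟ℕ k) xor σ k (vs p (inject₁ j))    ≡⟨ cong₂ _xor_ other-rank ih ⟩
      c xor does (toℕ t <? toℕ (inject₁ j))              ≡⟨ cong (c xor_) (does-⇔ t<j⇔t<j+1 (_ <? _) (_ <? _)) ⟩
      c xor does (toℕ t <? suc (toℕ j))                  ∎
      where
      open ≡-Reasoning
      other-rank : does (rank p j ≟ℕ k) ≡ false
      other-rank = dec-false (rank p j ≟ℕ k) (λ j-rank → j≢t (only-t j j-rank))
      t<j⇔t<j+1 : toℕ t < toℕ (inject₁ j) ⇔ toℕ t < suc (toℕ j)
      t<j⇔t<j+1 rewrite toℕ-inject₁ j =
        mk⇔ m<n⇒m<1+n (λ { (s≤s t≤j) → ≤∧≢⇒< t≤j (λ t≡j → j≢t (toℕ-injective (sym t≡j))) })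

  separating-rank : (p : Path T) {w β : ℕ} → w ≤ 1 → w < β → β ≤ len p → len p ≤ suc β →
    ∃[ k ] ((1 ≤ k × k ≤ r) × ∃[ c ] ((∀ x → toℕ x ≤ w → σ k (vs p x) ≡ c)
                                    × (∀ x → β ≤ toℕ x → σ k (vs p x) ≡ not c)))
  separating-rank p {w} {β} w≤1 w<β β≤len short =
    k , proj₁ (proj₂ ranking) _ _ (steps p t) , c , before , after
    where
    in-window? : ∀ s → Dec (InWindow w β s)
    in-window? s = (w ≤? toℕ s) ×-dec (toℕ s <? β)
    window : List (Fin (len p))
    window = filter in-window? (allFin (len p))
    t₀ : Fin (len p)
    t₀ = fromℕ< (<-≤-trans w<β β≤len)
    t₀∈W : InWindow w β t₀
    t₀∈W rewrite toℕ-fromℕ< (<-≤-trans w<β β≤len) = ≤-refl , w<β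
    t : Fin (len p)
    t = argmax (rank p) t₀ window
    k : ℕ
    k = rank p t
    c : Bool
    c = σ k (start p)
    t∈W : InWindow w β t
    t∈W = argmax-all (rank p) {P = InWindow w β} t₀∈W (All.all-filter in-window? (allFin (len p)))
    t-max : ∀ s → InWindow w β s → rank p s ≤ k
    t-max s s∈W = All-lookup (f[xs]≤f[argmax] t₀ window) (∈-filter⁺ in-window? (∈-allFin s) s∈W)
    switch : ∀ x → σ k (vs p x) ≡ c xor does (toℕ t <? toℕ x)
    switch = σ-along k p t refl (rank-unique-in-window p w≤1 short t t∈W t-max)
    before : ∀ x → toℕ x ≤ w → σ k (vs p x) ≡ c
    before x x≤w = begin
      σ k (vs p x)                  ≡⟨ switch x ⟩
      c xor does (toℕ t <? toℕ x)   ≡⟨ cong (c xor_) (dec-false (_ <? _) (≤⇒≯ (≤-trans x≤w (proj₁ t∈W)))) ⟩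
      c xor false                   ≡⟨ xor-identityʳ c ⟩
      c                             ∎
      where open ≡-Reasoning
    after : ∀ x → β ≤ toℕ x → σ k (vs p x) ≡ not c
    after x β≤x = begin
      σ k (vs p x)                  ≡⟨ switch x ⟩
      c xor does (toℕ t <? toℕ x)   ≡⟨ cong (c xor_) (dec-true (_ <? _) (<-≤-trans (proj₂ t∈W) β≤x)) ⟩
      c xor true                    ≡⟨ xor-comm c true ⟩
      true xor c                    ≡⟨ true-xor c ⟩
      not c                         ∎
      where open ≡-Reasoning

  separating-rank-list : ∀ us ms vs → Linked (Adj T) (us ++ ms ++ vs) → Unique (us ++ ms ++ vs) →
    1 ≤ length us → length us ≤ 2 → 1 ≤ length vs → length vs ≤ 2 →
    ∃[ k ] ((1 ≤ k × k ≤ r) × ∃[ c ] ((∀ {z} → z ∈ₗ us → σ k z ≡ c) × (∀ {z} → z ∈ₗ vs → σ k z ≡ not c)))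
  separating-rank-list (x ∷ us) ms vs linked unique _ (s≤s us≤1) 1≤vs vs≤2 =
    let k , k-range , c , before , after = separating-rank path us≤1 (s≤s (m≤m+n _ _)) β≤len len≤β+1
    in  k , k-range , c
        , (λ z∈ → case position-in-prefix (ms ++ vs) z∈ of λ where (s , refl , s≤s bound) → before s bound)
        , (λ z∈ → case position-in-suffix (x ∷ us) ms z∈ of λ where (s , refl , bound) → after s bound)
    where
    path : Path T
    path = listPath T x (us ++ ms ++ vs) linked unique
    len≡ : length (us ++ ms ++ vs) ≡ length us + (length ms + length vs)
    len≡ = trans (length-++ us) (cong (length us +_) (length-++ ms))
    β≤len : suc (length us + length ms) ≤ length (us ++ ms ++ vs)
    β≤len = subst (_ ≤_) (sym len≡) (proj₁ (window-bounds (length us) (length ms) 1≤vs vs≤2))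
    len≤β+1 : length (us ++ ms ++ vs) ≤ suc (suc (length us + length ms))
    len≤β+1 = subst (_≤ _) (sym len≡) (proj₂ (window-bounds (length us) (length ms) 1≤vs vs≤2))

-- The biclique cover

module Cover {n} (G : Graph n) (two : AtMostTwoMaxIndep G) (CT : CliqueTree (complement G)) where

  private
    H : Graph n
    H = complement G
    T : Graph (m CT)
    T = tree CT
    Node : Set
    Node = Fin (m CT)
  open UniqueP {A = Node} using (Unique)

  clique⊆node : ∀ {S} → IsClique H S → ∃[ i ] S ⊆ K CT i
  clique⊆node clique with maximalClique-⊇ H clique
  ... | M , maximal , S⊆M with K-onto CT M maximal
  ...   | i , refl = i , S⊆M

  node-of : ∀ u → ∃[ i ] u ∈ K CT i
  node-of u = Product.map₂ (λ u⊆K → u⊆K (x∈⁅x⁆ u)) (clique⊆node (singleton-isClique H u))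

  common-node : ∀ {u v} → u ≢ v → adj G u v ≡ false → ∃[ i ] (u ∈ K CT i × v ∈ K CT i)
  common-node u≢v nonadj =
    Product.map₂ (λ uv⊆K → uv⊆K (x∈p∪q⁺ (inj₁ (x∈⁅x⁆ _))) , uv⊆K (x∈p∪q⁺ (inj₂ (x∈⁅x⁆ _))))
                 (clique⊆node (pair-isClique H (complement-Adj⁺ G nonadj u≢v)))

  no-common-node : ∀ {u v i} → Adj G u v → u ∈ K CT i → v ∉ K CT i
  no-common-node {u} {v} {i} uv u∈ v∈ =
    true≢false (trans (sym uv) (complement-Adj⁻ G (proj₁ (K-max CT i) u v u∈ v∈ u≢v)))
    where
    true≢false : true ≢ false
    true≢false ()
    u≢v : u ≢ v
    u≢v refl = true≢false (trans (sym uv) (irrefl G u))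

  at-most-two-nodes : ∀ {u i j l} → u ∈ K CT i → u ∈ K CT j → u ∈ K CT l → i ≡ j ⊎ i ≡ l ⊎ j ≡ l
  at-most-two-nodes {u} {i} {j} {l} u∈i u∈j u∈l =
    Sum.map (K-inj CT) (Sum.map (K-inj CT) (K-inj CT))
      (two u (K CT i) (K CT j) (K CT l) (maxInd i) (maxInd j) (maxInd l) u∈i u∈j u∈l)
    where
    maxInd : ∀ i → IsMaximalIndependent G (K CT i)
    maxInd i = maximalClique⇒maximalIndependent G (K-max CT i)

  -- By the clique-intersection property every node on the tree path between two nodes containing u
  -- contains u as well, so that path has no room for a third node.
  two-nodes-adjacent : ∀ {u a i} → u ∈ K CT a → u ∈ K CT i → a ≢ i → Adj T a i
  two-nodes-adjacent {u} {a} {i} u∈a u∈i a≢i with proj₁ (isTree CT) a i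
  ... | p , refl , refl = short (len p) (vs p) (inj p) (steps p) on-path a≢i
    where
    on-path : ∀ l → u ∈ K CT (vs p l)
    on-path l = K-inter CT _ _ a≢i p refl refl l (x∈p∩q⁺ (u∈a , u∈i))
    short : ∀ l (f : Fin (suc l) → Node) → (∀ {x y} → f x ≡ f y → x ≡ y) →
            (∀ (s : Fin l) → Adj T (f (inject₁ s)) (f (fsuc s))) → (∀ x → u ∈ K CT (f x)) →
            f fzero ≢ f (fromℕ l) → Adj T (f fzero) (f (fromℕ l))
    short zero          f _     _     _  ends = ⊥-elim (ends refl)
    short (suc zero)    f _     steps _  _    = steps fzero
    short (suc (suc l)) f f-inj _     u∈ _
      with at-most-two-nodes (u∈ fzero) (u∈ (fsuc fzero)) (u∈ (fsuc (fsuc fzero)))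
    ... | inj₁ eq        = case f-inj eq of λ ()
    ... | inj₂ (inj₁ eq) = case f-inj eq of λ ()
    ... | inj₂ (inj₂ eq) = case f-inj eq of λ ()

  record Around (u : Fin n) (a : Node) : Set where
    field
      others   : List Node
      few      : length others ≤ 1
      linked   : Linked (Adj T) (a ∷ others)
      unique   : Unique (a ∷ others)
      contain  : All (λ z → u ∈ K CT z) (a ∷ others)
      complete : ∀ {z} → u ∈ K CT z → z ∈ₗ a ∷ others

  opaque
    around : ∀ {u a} → u ∈ K CT a → Around u a
    around {u} {a} u∈a with any? (λ j → ¬? (j ≟ a) ×-dec (u ∈? K CT j))
    ... | no none = record
      { others = [] ; few = z≤n ; linked = [-] ; unique = [] ∷ []
      ; contain = u∈a ∷ [] ; complete = complete }
      where
      complete : ∀ {z} → u ∈ K CT z → z ∈ₗ a ∷ []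
      complete {z} u∈z with z ≟ a
      ... | yes z≡a = here z≡a
      ... | no  z≢a = ⊥-elim (none (z , z≢a , u∈z))
    ... | yes (j , j≢a , u∈j) = record
      { others = j ∷ [] ; few = s≤s z≤n ; linked = two-nodes-adjacent u∈a u∈j a≢j ∷ [-]
      ; unique = (a≢j ∷ []) ∷ [] ∷ [] ; contain = u∈a ∷ u∈j ∷ [] ; complete = complete }
      where
      a≢j : a ≢ j
      a≢j = j≢a ∘ sym
      complete : ∀ {z} → u ∈ K CT z → z ∈ₗ a ∷ j ∷ []
      complete {z} u∈z with z ≟ a
      ... | yes z≡a = here z≡a
      ... | no  z≢a with at-most-two-nodes u∈z u∈a u∈j
      ...   | inj₁ z≡a        = ⊥-elim (z≢a z≡a)
      ...   | inj₂ (inj₁ z≡j) = there (here z≡j)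
      ...   | inj₂ (inj₂ a≡j) = ⊥-elim (a≢j a≡j)

  record Bridge (u v : Fin n) : Set where
    field
      a b    : Node
      mid    : List Node
      u∈a    : u ∈ K CT a
      v∈b    : v ∈ K CT b
      linked : Linked (Adj T) (a ∷ mid ∷ʳ b)
      unique : Unique mid
      u∉mid  : All (λ z → u ∉ K CT z) mid
      v∉mid  : All (λ z → v ∉ K CT z) mid

  opaque
    bridge : ∀ {u v} → Adj G u v → Bridge u v
    bridge {u} {v} uv with node-of u | node-of v
    ... | a₀ , u∈a₀ | b₀ , v∈b₀ with connected⇒route T (proj₁ (isTree CT)) a₀ b₀
    ... | route hs lk uq ar with lastSplit (λ z → u ∈? K CT z) {a₀ ∷ hs} (here u∈a₀)
    ... | pre , a , s , eq₁ , u∈a , u∉s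
      with firstSplit (λ z → v ∈? K CT z) (v-after s (trans (sym (lastOf-split pre eq₁)) ar))
      where
      v-after : ∀ s → lastOf a s ≡ b₀ → Any (λ z → v ∈ K CT z) s
      v-after []       refl   = ⊥-elim (no-common-node uv u∈a v∈b₀)
      v-after (y ∷ ys) last≡ = lose (lastOf-∈ y ys) (subst (λ z → v ∈ K CT z) (sym last≡) v∈b₀)
    ... | mid , b , rest , eq₂ , v∉mid , v∈b = record
      { a = a ; b = b ; mid = mid ; u∈a = u∈a ; v∈b = v∈b
      ; linked = Linked-cut (a ∷ mid) (subst (λ s → Linked (Adj T) (a ∷ s)) eq₂ from-a)
      ; unique = Unique-++⁻ˡ mid (subst Unique eq₂ (AllPairs.tail (Unique-++⁻ʳ pre (subst Unique eq₁ uq))))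
      ; u∉mid = All.++⁻ˡ mid (subst (All _) eq₂ u∉s)
      ; v∉mid = v∉mid
      }
      where
      from-a : Linked (Adj T) (a ∷ s)
      from-a = Linked-++⁻ʳ pre (subst (Linked (Adj T)) eq₁ lk)

  record Corridor (u v : Fin n) : Set where
    field
      us ms vs    : List Node
      linked      : Linked (Adj T) (us ++ ms ++ vs)
      unique      : Unique (us ++ ms ++ vs)
      us-size     : 1 ≤ length us × length us ≤ 2
      vs-size     : 1 ≤ length vs × length vs ≤ 2
      us-complete : ∀ {z} → u ∈ K CT z → z ∈ₗ us
      vs-complete : ∀ {z} → v ∈ K CT z → z ∈ₗ vs

  corridor : ∀ {u v} → Adj G u v → Corridor u v
  corridor {u} {v} uv = record
    { us = reverse (a ∷ is) ; ms = mid ; vs = b ∷ js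
    ; linked = Linked-reverse-join (Adj-sym T) (Around.linked U) right-linked
    ; unique = Unique.++⁺ (Unique-reverse (Around.unique U)) right-unique
                          (All-disjoint (All-tabulate (All-lookup (Around.contain U) ∘ reverse⁻))
                                        (All.++⁺ u∉mid u∉right))
    ; us-size = size (Around.few U) ; vs-size = s≤s z≤n , s≤s (Around.few V)
    ; us-complete = reverse⁺ ∘ Around.complete U ; vs-complete = Around.complete V
    }
    where
    open Bridge (bridge uv)
    U : Around u a
    U = around u∈a
    V : Around v b
    V = around v∈b
    is js : List Node
    is = Around.others U
    js = Around.others V
    right-linked : Linked (Adj T) (a ∷ mid ++ b ∷ js)
    right-linked = Linked-join (a ∷ mid) linked (Around.linked V)
    right-unique : Unique (mid ++ b ∷ js)
    right-unique = Unique.++⁺ unique (Around.unique V)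
                     (All-disjoint v∉mid (All-map (λ v∈ v∉ → v∉ v∈) (Around.contain V)))
    u∉right : All (λ z → u ∉ K CT z) (b ∷ js)
    u∉right = All-map (λ v∈ u∈ → no-common-node uv u∈ v∈) (Around.contain V)
    size : length is ≤ 1 → 1 ≤ length (reverse (a ∷ is)) × length (reverse (a ∷ is)) ≤ 2
    size few rewrite length-reverse (a ∷ is) = s≤s z≤n , s≤s few

  some-node : Node
  some-node = proj₁ (clique⊆node {∅} λ _ _ u∈ → ⊥-elim (∉⊥ u∈))

  module Bicliques {r φ} (ranking : IsEdgeRanking T r φ) where

    open Ranking (isTree CT) some-node ranking
    open Parity (isTree CT) some-node φ (proj₁ ranking) using (σ)

    uniformly? : ∀ k b u → Dec (∀ i → u ∈ K CT i → σ k i ≡ b)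
    uniformly? k b u = all? λ i → (u ∈? K CT i) →-dec (σ k i Bool.≟ b)

    biclique : ℕ → Subset n × Subset n
    biclique k = ⟦ uniformly? k false ⟧ , ⟦ uniformly? k true ⟧

    biclique-isBiclique : ∀ k → IsBiclique G (biclique k)
    biclique-isBiclique k = disjoint , complete
      where
      false≢true : false ≢ true
      false≢true ()
      apart : ∀ {u v i} → u ∈ K CT i → v ∈ K CT i → u ∈ proj₁ (biclique k) → v ∈ proj₂ (biclique k) → ⊥
      apart {u} {v} {i} u∈i v∈i u∈A v∈B = false≢true (begin
        false  ≡⟨ ∈⟦⟧⁻ (uniformly? k false) u∈A i u∈i ⟨
        σ k i  ≡⟨ ∈⟦⟧⁻ (uniformly? k true) v∈B i v∈i ⟩
        true   ∎)
        where open ≡-Reasoning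
      disjoint : ∀ v → v ∈ proj₁ (biclique k) → v ∉ proj₂ (biclique k)
      disjoint v v∈A v∈B = apart (proj₂ (node-of v)) (proj₂ (node-of v)) v∈A v∈B
      complete : ∀ u v → u ∈ proj₁ (biclique k) → v ∈ proj₂ (biclique k) → Adj G u v
      complete u v u∈A v∈B = Bool.¬-not nonadjacent-impossible
        where
        nonadjacent-impossible : adj G u v ≢ false
        nonadjacent-impossible uv = case u ≟ v of λ where
          (yes u≡v) → disjoint u u∈A (subst (_∈ proj₂ (biclique k)) (sym u≡v) v∈B)
          (no  u≢v) → let _ , u∈i , v∈i = common-node u≢v uv in apart u∈i v∈i u∈A v∈B

    edge-covered : ∀ {u v} → Adj G u v → ∃[ k ] ((1 ≤ k × k ≤ r) × CoversEdge (biclique k) u v)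
    edge-covered {u} {v} uv =
      let k , k-range , c , on-us , on-vs = separating-rank-list us ms vs′ linked unique
                                              (proj₁ us-size) (proj₂ us-size) (proj₁ vs-size) (proj₂ vs-size)
      in  k , k-range , covers k c (λ _ → on-us ∘ us-complete) (λ _ → on-vs ∘ vs-complete)
      where
      open Corridor (corridor uv) using (us; ms; linked; unique; us-size; vs-size; us-complete; vs-complete)
                                  renaming (vs to vs′)
      covers : ∀ k c → (∀ i → u ∈ K CT i → σ k i ≡ c) → (∀ i → v ∈ K CT i → σ k i ≡ not c) →
               CoversEdge (biclique k) u v
      covers k false u-side v-side = inj₁ (∈⟦⟧⁺ (uniformly? k false) u-side , ∈⟦⟧⁺ (uniformly? k true) v-side)
      covers k true  u-side v-side = inj₂ (∈⟦⟧⁺ (uniformly? k false) v-side , ∈⟦⟧⁺ (uniformly? k true) u-side)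

    bicliques : List (Subset n × Subset n)
    bicliques = applyUpTo (biclique ∘ suc) r

    bicliques-cover : IsBicliqueCover G bicliques
    bicliques-cover = All.applyUpTo⁺₂ (biclique ∘ suc) r (biclique-isBiclique ∘ suc) , covered
      where
      covered : ∀ u v → Adj G u v → Any (λ X → CoversEdge X u v) bicliques
      covered u v uv = case edge-covered uv of λ where
        (suc k , (s≤s z≤n , k<r) , covers) → applyUpTo⁺ (biclique ∘ suc) covers k<r

mainTheorem10 : ∀ {n} (G : Graph n) → IsCoChordal G → AtMostTwoMaxIndep G →
    (CT : CliqueTree (complement G)) →
    ∀ (r : ℕ) (φ : Fin (m CT) → Fin (m CT) → ℕ) → IsEdgeRanking (tree CT) r φ →
    Σ (List (Subset n × Subset n)) λ C → IsBicliqueCover G C × length C ≤ r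
mainTheorem10 G _ two CT r φ ranking =
  bicliques , bicliques-cover , ≤-reflexive (length-applyUpTo _ r)
  where open Cover.Bicliques G two CT ranking
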